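{- Let $M$ be a $k$-connected matroid on $E$, where $k\ge2$ and $|E|\ge\max\{3k-5,2\}$. Then $M$ has a unique tangle $\mathcal T$ of order $k$. Moreover, a subset $A\subseteq E$ belongs to $\mathcal T$ if and only if $|A|\le k-2$.
   Context: For a matroid $M$ on $E$ with rank function $r$, $\lambda_M(X)=r(X)+r(E-X)-r(M)+1$. $M$ is $k$-connected (in Tutte's sense) if, for no $l<k$, there is a partition $(A,B)$ of $E$ with $|A|,|B|\ge l$ and $r(A)+r(B)-r(M)\le l-1$. A tangle of order $k$ in $M$ is a collection $\mathcal T$ of subsets of $E$ such that (T1) $\lambda_M(A)<k$ for all $A\in\mathcal T$; (T2) if $\lambda_M(A)\le k-1$ then $A\in\mathcal T$ or $E-A\in\mathcal T$; (T3) if $A,B,C\in\mathcal T$ then $A\cup B\cup C\ne E$; (T4) $E-\{e\}\notin\mathcal T$ for each $e\in E$. -}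

module Defs where

open import Data.Nat using (ℕ; _+_; _∸_; _≤_; _<_)
open import Data.Fin using (Fin)
open import Data.Fin.Subset using (Subset; ⊤; ⁅_⁆; ∁; _∪_; _∩_; _⊆_; ∣_∣)
open import Data.Product using (Σ; _×_)
import Data.Sum
open import Relation.Nullary using (¬_)
open import Relation.Binary.PropositionalEquality using (_≡_)

record Matroid (n : ℕ) : Set where
  field
    r         : Subset n → ℕ
    r-bounded : ∀ X → r X ≤ ∣ X ∣
    r-mono    : ∀ X Y → X ⊆ Y → r X ≤ r Y
    r-submod  : ∀ X Y → r (X ∪ Y) + r (X ∩ Y) ≤ r X + r Y

module _ {n : ℕ} (M : Matroid n) where
  open Matroid M

  -- λ_M(X) = r(X) + r(E - X) - r(M) + 1   (the truncated ∸ is exact by submodularity)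
  connectivity : Subset n → ℕ
  connectivity X = (r X + r (∁ X) ∸ r ⊤) + 1

  -- M is k-connected: for no l < k is there a partition (A, E - A) with
  -- |A|, |E - A| ≥ l and r(A) + r(E - A) - r(M) ≤ l - 1
  -- (the last inequality is written over ℕ as r(A)+r(E-A)+1 ≤ l + r(M)).
  IsKConnected : ℕ → Set
  IsKConnected k = ∀ l → l < k → ¬ (Σ (Subset n) λ A →
      (l ≤ ∣ A ∣) × (l ≤ ∣ ∁ A ∣) × (r A + r (∁ A) + 1 ≤ l + r ⊤))

  record IsTangle (k : ℕ) (𝒯 : Subset n → Set) : Set where
    field
      T1 : ∀ A → 𝒯 A → connectivity A < k
      T2 : ∀ A → connectivity A ≤ k ∸ 1 → Data.Sum._⊎_ (𝒯 A) (𝒯 (∁ A))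
      T3 : ∀ A B C → 𝒯 A → 𝒯 B → 𝒯 C → ¬ (A ∪ B ∪ C ≡ ⊤)
      T4 : ∀ e → ¬ 𝒯 (∁ ⁅ e ⁆)

module Submission where

-- Write k = j + 2.  Two facts about subsets A of E hold in
-- any matroid: λ(A) ≤ |A| + 1, and r(A) + r(E - A) + 1 = λ(A) + r(M).
-- The second shows that in a k-connected matroid every A with λ(A) < k
-- has a side (A or E - A) of size smaller than λ(A), hence at most j.
--
-- Uniqueness holds for every tangle 𝒯 of order k: the axioms force every
-- set with at most j elements into 𝒯 (by induction on the size, adding
-- one element at a time: if 𝒯 contains A and B, then it also contains any
-- X ⊆ A ∪ B with λ(X) ≤ k - 1, since otherwise A, B, E - X cover E).
-- Conversely a member of 𝒯 cannot have a complement of size at most j,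
-- so by the k-connectivity fact it has at most j elements.
--
-- Existence: the family of sets of size at most j is a tangle of order k
-- as soon as |E| > 3j (three members never cover E) and |E| - 1 > j
-- (complements of singletons are too large).

open import Defs
open import Data.Nat using (ℕ; zero; suc; _+_; _*_; _∸_; _≤_; _<_; _⊔_; z≤n; s≤s; _≤?_; s≤s⁻¹)
open import Data.Nat.Properties hiding (_≟_)
open import Data.Fin using (Fin; _≟_)
open import Data.Fin.Subset
  using (Subset; ∣_∣; ⊤; ⊥; ⁅_⁆; ∁; _∪_; _∩_; _⊆_; _∈_; _-_; inside; outside)
open import Data.Fin.Subset.Properties
open import Data.Vec using (_∷_; [])
open import Data.Product using (Σ; _×_; _,_; proj₁; proj₂)
open import Data.Sum using (_⊎_; inj₁; inj₂)
open import Data.Empty using (⊥-elim)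
open import Relation.Nullary using (¬_; yes; no; contradiction)
open import Relation.Binary.PropositionalEquality
  using (_≡_; refl; sym; cong; subst; module ≡-Reasoning)
open import Function.Bundles using (_⇔_; mk⇔)

∣p∪q∣≤∣p∣+∣q∣ : ∀ {n} (p q : Subset n) → ∣ p ∪ q ∣ ≤ ∣ p ∣ + ∣ q ∣
∣p∪q∣≤∣p∣+∣q∣ [] [] = z≤n
∣p∪q∣≤∣p∣+∣q∣ (outside ∷ p) (outside ∷ q) = ∣p∪q∣≤∣p∣+∣q∣ p q
∣p∪q∣≤∣p∣+∣q∣ (inside ∷ p) (x ∷ q) =
  s≤s (≤-trans (∣p∪q∣≤∣p∣+∣q∣ p q) (+-monoʳ-≤ ∣ p ∣ (∣p∣≤∣x∷p∣ x q)))
∣p∪q∣≤∣p∣+∣q∣ (outside ∷ p) (inside ∷ q) =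
  subst (suc ∣ p ∪ q ∣ ≤_) (sym (+-suc ∣ p ∣ ∣ q ∣)) (s≤s (∣p∪q∣≤∣p∣+∣q∣ p q))

⊆⇒∪∁≡⊤ : ∀ {n} {X Y : Subset n} → X ⊆ Y → Y ∪ ∁ X ≡ ⊤
⊆⇒∪∁≡⊤ {X = X} X⊆Y = ⊆-antisym ⊆⊤ λ {x} _ → x∈p∪q⁺ (side x)
  where
  side : ∀ x → x ∈ _ ⊎ x ∈ ∁ X
  side x with x ∈? X
  ... | yes x∈X = inj₁ (X⊆Y x∈X)
  ... | no x∉X = inj₂ (x∉p⇒x∈∁p x∉X)

∁⊥≡⊤ : ∀ {n} → ∁ (⊥ {n}) ≡ ⊤
∁⊥≡⊤ = ⊆-antisym ⊆⊤ λ _ → x∉p⇒x∈∁p ∉⊥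

⊆-minus-∪-singleton : ∀ {n} (X : Subset n) (x : Fin n) → X ⊆ (X - x) ∪ ⁅ x ⁆
⊆-minus-∪-singleton X x {y} y∈X with y ≟ x
... | yes refl = x∈p∪q⁺ (inj₂ (x∈⁅x⁆ x))
... | no y≢x = x∈p∪q⁺ (inj₁ (x∈p∧x≢y⇒x∈p-y y∈X y≢x))

module MatroidConnectivity {n : ℕ} (M : Matroid n) where
  open Matroid M

  -- Submodularity applied to A and E - A: r(M) ≤ r(A) + r(E - A).
  r⊤≤r+r∁ : ∀ A → r ⊤ ≤ r A + r (∁ A)
  r⊤≤r+r∁ A = ≤-trans (m≤m+n (r ⊤) (r (A ∩ ∁ A)))
    (subst (λ Z → r Z + r (A ∩ ∁ A) ≤ r A + r (∁ A)) (p∪∁p≡⊤ A) (r-submod A (∁ A)))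

  connectivity-exact : ∀ A → r A + r (∁ A) + 1 ≡ connectivity M A + r ⊤
  connectivity-exact A = begin
    s + 1                 ≡⟨ cong (_+ 1) (sym (m∸n+n≡m (r⊤≤r+r∁ A))) ⟩
    (s ∸ r ⊤) + r ⊤ + 1   ≡⟨ +-assoc (s ∸ r ⊤) (r ⊤) 1 ⟩
    (s ∸ r ⊤) + (r ⊤ + 1) ≡⟨ cong ((s ∸ r ⊤) +_) (+-comm (r ⊤) 1) ⟩
    (s ∸ r ⊤) + (1 + r ⊤) ≡⟨ sym (+-assoc (s ∸ r ⊤) 1 (r ⊤)) ⟩
    (s ∸ r ⊤) + 1 + r ⊤   ∎
    where
    open ≡-Reasoning
    s = r A + r (∁ A)

  -- λ(A) ≤ |A| + 1, because r(A) ≤ |A| and r(E - A) ≤ r(M).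
  connectivity≤suc∣∣ : ∀ A → connectivity M A ≤ suc ∣ A ∣
  connectivity≤suc∣∣ A = subst (_≤ suc ∣ A ∣) (+-comm 1 _) (s≤s (begin
    r A + r (∁ A) ∸ r ⊤ ≤⟨ ∸-monoˡ-≤ (r ⊤) (+-monoʳ-≤ (r A) (r-mono (∁ A) ⊤ ⊆⊤)) ⟩
    r A + r ⊤ ∸ r ⊤     ≡⟨ m+n∸n≡m (r A) (r ⊤) ⟩
    r A                 ≤⟨ r-bounded A ⟩
    ∣ A ∣               ∎))
    where open ≤-Reasoning

  -- In a k-connected matroid, a set A with λ(A) < k has a side strictly
  -- smaller than λ(A); otherwise (A, E - A) is a forbidden l-separation
  -- with l = λ(A).
  small-side : ∀ {k} → IsKConnected M k → ∀ A → connectivity M A < k →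
               ∣ A ∣ < connectivity M A ⊎ ∣ ∁ A ∣ < connectivity M A
  small-side conn A λA<k with connectivity M A ≤? ∣ A ∣ | connectivity M A ≤? ∣ ∁ A ∣
  ... | no λA≰∣A∣ | _ = inj₁ (≰⇒> λA≰∣A∣)
  ... | yes _ | no λA≰∣∁A∣ = inj₂ (≰⇒> λA≰∣∁A∣)
  ... | yes λA≤∣A∣ | yes λA≤∣∁A∣ =
    contradiction (A , λA≤∣A∣ , λA≤∣∁A∣ , ≤-reflexive (connectivity-exact A))
                  (conn (connectivity M A) λA<k)

module TangleMembership {n : ℕ} (M : Matroid n) (j : ℕ)
    (𝒯 : Subset n → Set) (tangle : IsTangle M (suc (suc j)) 𝒯) where
  open IsTangle tangle
  open MatroidConnectivity M

  connectivity-of-small : ∀ {X} → ∣ X ∣ ≤ j → connectivity M X ≤ suc j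
  connectivity-of-small {X} ∣X∣≤j = ≤-trans (connectivity≤suc∣∣ X) (s≤s ∣X∣≤j)

  no-cover : ∀ {A B X} → 𝒯 A → 𝒯 B → X ⊆ A ∪ B → ¬ 𝒯 (∁ X)
  no-cover {A} {B} {X} tA tB X⊆A∪B t∁X = T3 A B (∁ X) tA tB t∁X (begin
    A ∪ B ∪ ∁ X   ≡⟨ sym (∪-assoc A B (∁ X)) ⟩
    (A ∪ B) ∪ ∁ X ≡⟨ ⊆⇒∪∁≡⊤ X⊆A∪B ⟩
    ⊤             ∎)
    where open ≡-Reasoning

  complement-excluded : ∀ {A} → 𝒯 A → ¬ 𝒯 (∁ A)
  complement-excluded tA = no-cover tA tA (p⊆p∪q _)

  absorb : ∀ {A B X} → 𝒯 A → 𝒯 B → X ⊆ A ∪ B → connectivity M X ≤ suc j → 𝒯 X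
  absorb tA tB X⊆A∪B λX≤ with T2 _ λX≤
  ... | inj₁ tX = tX
  ... | inj₂ t∁X = contradiction t∁X (no-cover tA tB X⊆A∪B)

  ∅-in : 𝒯 ⊥
  ∅-in with T2 ⊥ (connectivity-of-small (subst (_≤ j) (sym (∣⊥∣≡0 n)) z≤n))
  ... | inj₁ t∅ = t∅
  ... | inj₂ t∁∅ = ⊥-elim (T3 ⊤ ⊤ ⊤ t⊤ t⊤ t⊤ (∪-zeroˡ (⊤ ∪ ⊤)))
    where
    t⊤ : 𝒯 ⊤
    t⊤ = subst 𝒯 ∁⊥≡⊤ t∁∅

  -- Singletons are in 𝒯 by T2, since T4 rules out their complements.
  singleton-in : 1 ≤ j → ∀ x → 𝒯 ⁅ x ⁆
  singleton-in 1≤j x with T2 ⁅ x ⁆ (connectivity-of-small (subst (_≤ j) (sym (∣⁅x⁆∣≡1 x)) 1≤j))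
  ... | inj₁ tx = tx
  ... | inj₂ t∁x = contradiction t∁x (T4 x)

  -- Induction on a size bound i ≤ j: X = (X - x) ∪ {x} for any x ∈ X.
  small-in : ∀ i → i ≤ j → ∀ X → ∣ X ∣ ≤ i → 𝒯 X
  small-in i i≤j X ∣X∣≤i with nonempty? X
  ... | no X-empty = subst 𝒯 (sym (Empty-unique X-empty)) ∅-in
  small-in zero i≤j X ∣X∣≤0 | yes (x , x∈X) =
    contradiction ∣X∣≤0 (<⇒≱ (≤-<-trans z≤n (x∈p⇒∣p-x∣<∣p∣ x∈X)))
  small-in (suc i) i≤j X ∣X∣≤i | yes (x , x∈X) =
    absorb (small-in i (≤-trans (n≤1+n i) i≤j) (X - x) ∣X-x∣≤i)
           (singleton-in (≤-trans (s≤s z≤n) i≤j) x)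
           (⊆-minus-∪-singleton X x)
           (connectivity-of-small (≤-trans ∣X∣≤i i≤j))
    where
    ∣X-x∣≤i : ∣ X - x ∣ ≤ i
    ∣X-x∣≤i = s≤s⁻¹ (≤-trans (x∈p⇒∣p-x∣<∣p∣ x∈X) ∣X∣≤i)

  small-in-tangle : ∀ X → ∣ X ∣ ≤ j → 𝒯 X
  small-in-tangle X ∣X∣≤j = small-in j ≤-refl X ∣X∣≤j

  -- In a (j+2)-connected matroid the members of 𝒯 are exactly the sets of
  -- size at most j: a member with a small complement would clash with T3.
  tangle-characterised : IsKConnected M (suc (suc j)) → ∀ A → 𝒯 A ⇔ (∣ A ∣ ≤ j)
  tangle-characterised conn A = mk⇔ member-small (small-in-tangle A)
    where
    member-small : 𝒯 A → ∣ A ∣ ≤ j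
    member-small tA with small-side conn A (T1 A tA)
    ... | inj₁ ∣A∣<λA = s≤s⁻¹ (≤-trans ∣A∣<λA (s≤s⁻¹ (T1 A tA)))
    ... | inj₂ ∣∁A∣<λA = contradiction
      (small-in-tangle (∁ A) (s≤s⁻¹ (≤-trans ∣∁A∣<λA (s≤s⁻¹ (T1 A tA)))))
      (complement-excluded tA)

small-sets-tangle : ∀ {n} (M : Matroid n) (j : ℕ) → 3 * j < n → suc j < n →
  IsKConnected M (suc (suc j)) → IsTangle M (suc (suc j)) (λ A → ∣ A ∣ ≤ j)
small-sets-tangle {n} M j 3j<n j+1<n conn = record
  { T1 = λ A ∣A∣≤j → s≤s (≤-trans (connectivity≤suc∣∣ A) (s≤s ∣A∣≤j))
  ; T2 = λ A λA≤ → Data.Sum.map (λ lt → s≤s⁻¹ (≤-trans lt λA≤))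
                                (λ lt → s≤s⁻¹ (≤-trans lt λA≤))
                                (small-side conn A (s≤s λA≤))
  ; T3 = λ A B C ∣A∣≤j ∣B∣≤j ∣C∣≤j A∪B∪C≡⊤ → <⇒≱ 3j<n (begin
      n                       ≡⟨ sym (∣⊤∣≡n n) ⟩
      ∣ ⊤ {n} ∣               ≡⟨ cong ∣_∣ (sym A∪B∪C≡⊤) ⟩
      ∣ A ∪ B ∪ C ∣           ≤⟨ ∣p∪q∣≤∣p∣+∣q∣ A (B ∪ C) ⟩
      ∣ A ∣ + ∣ B ∪ C ∣       ≤⟨ +-monoʳ-≤ ∣ A ∣ (∣p∪q∣≤∣p∣+∣q∣ B C) ⟩
      ∣ A ∣ + (∣ B ∣ + ∣ C ∣) ≤⟨ +-mono-≤ ∣A∣≤j (+-mono-≤ ∣B∣≤j (≤-trans ∣C∣≤j (≤-reflexive (sym (+-identityʳ j))))) ⟩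
      3 * j                   ∎)
  ; T4 = λ e ∣∁e∣≤j → <⇒≱ (∸-monoˡ-≤ 1 j+1<n) (begin
      n ∸ 1         ≡⟨ cong (n ∸_) (sym (∣⁅x⁆∣≡1 e)) ⟩
      n ∸ ∣ ⁅ e ⁆ ∣ ≡⟨ sym (∣∁p∣≡n∸∣p∣ ⁅ e ⁆) ⟩
      ∣ ∁ ⁅ e ⁆ ∣   ≤⟨ ∣∁e∣≤j ⟩
      j             ∎)
  }
  where
  open MatroidConnectivity M
  open ≤-Reasoning

-- For k = j + 2, the bound max(3k - 5, 2) ≤ n gives 3j < n and j + 1 < n
-- (the latter from 2 ≤ n when j = 0, and from j + 2 ≤ 3j + 1 otherwise).
size-bounds : ∀ j n → ((3 * suc (suc j) ∸ 5) ⊔ 2) ≤ n → 3 * j < n × suc j < n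
size-bounds j n bound = 3j<n , j+1<n j 3j<n
  where
  3k-5≡3j+1 : 3 * suc (suc j) ∸ 5 ≡ suc (3 * j)
  3k-5≡3j+1 = cong (_∸ 5) (*-distribˡ-+ 3 2 j)
  3j<n : 3 * j < n
  3j<n = ≤-trans (≤-reflexive (sym 3k-5≡3j+1)) (≤-trans (m≤m⊔n _ 2) bound)
  j+1<n : ∀ i → 3 * i < n → suc i < n
  j+1<n zero _ = ≤-trans (m≤n⊔m (3 * suc (suc j) ∸ 5) 2) bound
  j+1<n (suc i) 3i<n = ≤-trans (s≤s (m<m+n (suc i) (s≤s z≤n))) 3i<n

corollary2p4 : (n : ℕ) (M : Matroid n) (k : ℕ) → 2 ≤ k → ((3 * k ∸ 5) ⊔ 2) ≤ n →
    IsKConnected M k →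
    Σ (Subset n → Set) λ 𝒯 →
    IsTangle M k 𝒯
    × (∀ 𝒯′ → IsTangle M k 𝒯′ → ∀ A → 𝒯′ A ⇔ 𝒯 A)
    × (∀ A → 𝒯 A ⇔ (∣ A ∣ ≤ k ∸ 2))
corollary2p4 n M (suc zero) (s≤s ()) _ _
corollary2p4 n M (suc (suc j)) _ bound conn =
    (λ A → ∣ A ∣ ≤ j)
  , small-sets-tangle M j (proj₁ bounds) (proj₂ bounds) conn
  , (λ 𝒯′ tangle → TangleMembership.tangle-characterised M j 𝒯′ tangle conn)
  , (λ A → mk⇔ (λ h → h) (λ h → h))
  where
  bounds : 3 * j < n × suc j < n
  bounds = size-bounds j n bound
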